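{- Let $\sigma$ be a unimodal vocabulary and $k>0$. For all pointed $\sigma$-structures: (i) $\varepsilon:\mathbb{H}_k(\mathcal{A},a)\to(\mathcal{A},a)$ is a morphism; (ii) for every morphism $h:\mathbb{H}_k(\mathcal{A},a)\to(\mathcal{B},b)$, $h^*:\mathbb{H}_k(\mathcal{A},a)\to\mathbb{H}_k(\mathcal{B},b)$ is a well-defined morphism; (iii) for all morphisms $h:\mathbb{H}_k(\mathcal{A},a)\to(\mathcal{B},b)$ and $g:\mathbb{H}_k(\mathcal{B},b)\to(\mathcal{C},c)$: $\varepsilon\circ h^*=h$, $\varepsilon^*=\mathrm{id}_{\mathbb{H}_k(\mathcal{A},a)}$, and $(g\circ h^*)^*=g^*\circ h^*$. That is, $(\mathbb{H}_k,\varepsilon,(\cdot)^*)$ is a comonad in Kleisli form on the category of pointed $\sigma$-structures.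
   Context: A unimodal vocabulary consists of unary predicate symbols and one binary relation symbol $E$. The category of pointed $\sigma$-structures has objects $(\mathcal{A},a)$, $a\in A$, and morphisms the homomorphisms preserving the point. $\mathbb{H}_k(\mathcal{A},a)$: universe the sequences $\langle a_0,\ldots,a_l\rangle$ of elements of $A$ with $0\le l\le k$, $a_0=a$, and for each $0<j\le l$ some $i<j$ with $E^{\mathcal{A}}(a_i,a_j)$; with $\varepsilon(s)$ the last element of $s$ and $\sqsubseteq$ the prefix order, $P(s)$ iff $P^{\mathcal{A}}(\varepsilon(s))$ for unary $P$, and $E(s,t)$ iff $s,t$ are $\sqsubseteq$-comparable and $E^{\mathcal{A}}(\varepsilon(s),\varepsilon(t))$; distinguished element $\langle a\rangle$. The coKleisli extension of $h$ is $h^*(\langle a_0,a_1,\ldots,a_i\rangle)=\langle h(\langle a_0\rangle),h(\langle a_0,a_1\rangle),\ldots,h(\langle a_0,\ldots,a_i\rangle)\rangle$. -}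

module Defs where

open import Data.Nat using (ℕ; zero; suc; _≤_; _<_; z≤n; s≤s; _⊓_)
open import Data.Nat.Properties using (≤-trans; <-trans; <-≤-trans; m⊓n≤n)
open import Data.Fin using (Fin; zero; suc; toℕ; fromℕ<)
open import Data.Fin.Properties using (toℕ-injective; toℕ-fromℕ<)
open import Data.List using (List; []; _∷_; length; take; map; _++_)
open import Data.List.Properties using (length-take)
open import Data.Fin using () renaming (_<_ to _<ᶠ_)
open import Data.Product using (Σ; _×_; _,_; proj₁; proj₂; ∃)
open import Data.Sum using (_⊎_)
open import Relation.Binary.PropositionalEquality
  using (_≡_; refl; sym; trans; cong; subst)

-- A unimodal vocabulary σ: a set `Pred` of unary predicate symbols,
-- together with the single binary relation symbol E.
-- A σ-structure interprets each unary symbol and E.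

record Structure (Pred : Set) : Set₁ where
  field
    Carrier : Set
    P       : Pred → Carrier → Set
    E       : Carrier → Carrier → Set

record Pointed (Pred : Set) : Set₁ where
  constructor _,,_
  field
    str   : Structure Pred
    point : Structure.Carrier str
  open Structure str public

open Pointed public

record Hom {Pred : Set} (X Y : Pointed Pred) : Set where
  field
    fun    : Carrier X → Carrier Y
    pres-P : ∀ p x → P X p x → P Y p (fun x)
    pres-E : ∀ x y → E X x y → E Y (fun x) (fun y)
    pres-• : fun (point X) ≡ point Y

open Hom public

_∘H_ : ∀ {Pred} {X Y Z : Pointed Pred} → Hom Y Z → Hom X Y → Hom X Z
fun    (g ∘H h) x = fun g (fun h x)
pres-P (g ∘H h) p x px = pres-P g p _ (pres-P h p x px)
pres-E (g ∘H h) x y exy = pres-E g _ _ (pres-E h x y exy)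
pres-• (_∘H_ {Z = Z} g h) = trans (cong (fun g) (pres-• h)) (pres-• g)

module _ {C : Set} (E : C → C → Set) where

  Connected : List C → Set
  Connected xs = (j : Fin (length xs)) → 0 < toℕ j →
    Σ (Fin (length xs)) λ i → toℕ i < toℕ j × E (lookup xs i) (lookup xs j)
    where open Data.List using (lookup)

lastOf : ∀ {C : Set} → C → List C → C
lastOf x []       = x
lastOf x (y ∷ ys) = lastOf y ys

_⊑_ : ∀ {C : Set} → List C → List C → Set
xs ⊑ ys = Σ _ λ zs → xs ++ zs ≡ ys

-- A sequence is represented as  a ∷ rest  (so a₀ = a by construction);
-- the side conditions are proof-irrelevant, so two sequences are equal
-- iff their underlying lists are equal.

module _ {Pred : Set} (k : ℕ) (X : Pointed Pred) where

  record Seq : Set where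
    constructor mkSeq
    field
      rest   : List (Carrier X)
      .len   : length rest ≤ k
      .conn  : Connected (E X) (point X ∷ rest)

open Seq public

elems : ∀ {Pred} {k} {X : Pointed Pred} → Seq k X → List (Carrier X)
elems {X = X} s = point X ∷ rest s

ε : ∀ {Pred} {k} {X : Pointed Pred} → Seq k X → Carrier X
ε {X = X} s = lastOf (point X) (rest s)

ℍ : ∀ {Pred} (k : ℕ) → Pointed Pred → Pointed Pred
ℍ {Pred} k X = record
  { Carrier = Seq k X
  ; P = λ p s → P X p (ε s)
  ; E = λ s t → ((elems s ⊑ elems t) ⊎ (elems t ⊑ elems s))
                × E X (ε s) (ε t)
  } ,, mkSeq [] z≤n (λ { zero () })

private
  embed : ∀ {C : Set} m (xs : List C) → Fin (length (take m xs)) → Fin (length xs)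
  embed (suc m) (x ∷ xs) zero    = zero
  embed (suc m) (x ∷ xs) (suc j) = suc (embed m xs j)

  toℕ-embed : ∀ {C : Set} m (xs : List C) j → toℕ (embed m xs j) ≡ toℕ j
  toℕ-embed (suc m) (x ∷ xs) zero    = refl
  toℕ-embed (suc m) (x ∷ xs) (suc j) = cong suc (toℕ-embed m xs j)

  lookup-embed : ∀ {C : Set} m (xs : List C) j →
    Data.List.lookup (take m xs) j ≡ Data.List.lookup xs (embed m xs j)
  lookup-embed (suc m) (x ∷ xs) zero    = refl
  lookup-embed (suc m) (x ∷ xs) (suc j) = lookup-embed m xs j

  conn-take : ∀ {C : Set} (E : C → C → Set) m (xs : List C) →
    Connected E xs → Connected E (take m xs)
  conn-take E m xs c j 0<j with c (embed m xs j) (subst (0 <_) (sym (toℕ-embed m xs j)) 0<j)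
  ... | i , i<ej , e = i' , i'<j , subst₂ E li lj e
    where
    open Data.List using (lookup)
    i<j : toℕ i < toℕ j
    i<j = subst (toℕ i <_) (toℕ-embed m xs j) i<ej
    i' : Fin (length (take m xs))
    i' = fromℕ< (<-trans i<j (Data.Fin.Properties.toℕ<n j))
    i'<j : toℕ i' < toℕ j
    i'<j = subst (_< toℕ j) (sym (toℕ-fromℕ< _)) i<j
    li : lookup xs i ≡ lookup (take m xs) i'
    li = trans (cong (lookup xs)
                 (toℕ-injective (trans (sym (toℕ-fromℕ< _))
                                       (sym (toℕ-embed m xs i')))))
               (sym (lookup-embed m xs i'))
    lj : lookup xs (embed m xs j) ≡ lookup (take m xs) j
    lj = sym (lookup-embed m xs j)
    subst₂ : ∀ {A : Set} (R : A → A → Set) {a b c d} → a ≡ b → c ≡ d → R a c → R b d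
    subst₂ R refl refl r = r

prefix : ∀ {Pred} {k} {X : Pointed Pred} (s : Seq k X) →
         Fin (suc (length (rest s))) → Seq k X
prefix {k = k} {X = X} (mkSeq r l c) i =
  mkSeq (take (toℕ i) r)
        (≤-trans (subst (_≤ length r) (sym (length-take (toℕ i) r))
                        (m⊓n≤n (toℕ i) (length r)))
                 l)
        (conn-take (E X) (suc (toℕ i)) (point X ∷ r) c)

starList : ∀ {Pred} {k} {X Y : Pointed Pred} →
           Hom (ℍ k X) Y → Seq k X → List (Carrier Y)
starList h s = map (λ i → fun h (prefix s i)) (Data.List.allFin (suc (length (rest s))))

{-# OPTIONS --safe #-}
-- h* sends a sequence to the sequence of h-values on its prefixes, so everything
-- reduces to two facts about prefixes. Prefixes of comparable sequences agree at
-- equal lengths: hence h* is monotone for the prefix order (so preserves E) and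
-- commutes with taking prefixes, which is the law (g ∘ h*)* = g* ∘ h*. And an
-- E-edge from an earlier to a later element of s is an E-edge between comparable
-- prefixes of s in ℍ_k: hence h*(s) is again a sequence.
module Submission where

open import Defs
open import Data.Nat using (ℕ; zero; suc; _<_; _≤_; s≤s; _⊓_; s≤s⁻¹)
open import Data.Nat.Properties using (≤-refl; <⇒≤; m≤n⇒m⊓n≡m; suc-injective)
open import Data.Fin using (Fin; zero; suc; toℕ; fromℕ)
open import Data.Fin.Properties using (toℕ-fromℕ; toℕ≤pred[n])
open import Data.List using (List; _∷_; length; take; drop; _++_; tabulate; lookup)
open import Data.List.Properties
  using (length-++-≤ˡ; length-take; take-all; take-take; take++drop≡id; ∷-injectiveʳ;
         length-tabulate; tabulate-cong; tabulate-lookup; map-tabulate)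
open import Data.Product using (Σ; _×_; _,_)
open import Data.Sum using (inj₁) renaming (map to map⊎)
open import Function using (id; _∘_)
open import Relation.Binary.PropositionalEquality
open ≡-Reasoning

private variable
  C : Set
  n m : ℕ

∷-⊑ : ∀ {xs ys : List C} x → xs ⊑ ys → (x ∷ xs) ⊑ (x ∷ ys)
∷-⊑ x (zs , eq) = zs , cong (x ∷_) eq

⊑-length : ∀ {xs ys : List C} → xs ⊑ ys → length xs ≤ length ys
⊑-length {xs = xs} (zs , refl) = length-++-≤ˡ xs

take-⊑ : ∀ m (xs : List C) → take m xs ⊑ xs
take-⊑ m xs = drop m xs , take++drop≡id m xs

take-mono-⊑ : ∀ {m m'} (xs : List C) → m ≤ m' → take m xs ⊑ take m' xs
take-mono-⊑ {m = m} {m'} xs m≤m' =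
  subst (_⊑ take m' xs) take-take-≤ (take-⊑ m (take m' xs))
  where
  take-take-≤ : take m (take m' xs) ≡ take m xs
  take-take-≤ = trans (take-take m m' xs) (cong (λ a → take a xs) (m≤n⇒m⊓n≡m m≤m'))

take-++ : ∀ m (xs ys : List C) → m ≤ length xs → take m (xs ++ ys) ≡ take m xs
take-++ zero    xs       ys _         = refl
take-++ (suc m) (x ∷ xs) ys (s≤s m≤l) = cong (x ∷_) (take-++ m xs ys m≤l)

lastOf-take : (x : C) (xs : List C) (i : Fin (suc (length xs))) →
              lastOf x (take (toℕ i) xs) ≡ lookup (x ∷ xs) i
lastOf-take x xs       zero    = refl
lastOf-take x (y ∷ xs) (suc i) = lastOf-take y xs i

lastOf-tabulate : (f : Fin (suc n) → C) →
                  lastOf (f zero) (tabulate (f ∘ suc)) ≡ f (fromℕ n)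
lastOf-tabulate {n = zero}  f = refl
lastOf-tabulate {n = suc n} f = lastOf-tabulate (f ∘ suc)

_≐_ : (Fin n → C) → (Fin m → C) → Set
f ≐ g = ∀ i j → toℕ i ≡ toℕ j → f i ≡ g j

lookup-tabulate-≐ : (f : Fin n → C) → lookup (tabulate f) ≐ f
lookup-tabulate-≐ f zero    zero    _  = refl
lookup-tabulate-≐ f (suc i) (suc j) eq = lookup-tabulate-≐ (f ∘ suc) i j (suc-injective eq)

tabulate-≐ : {f : Fin n → C} {g : Fin m → C} → n ≡ m → f ≐ g → tabulate f ≡ tabulate g
tabulate-≐ refl f≐g = tabulate-cong (λ i → f≐g i i refl)

tabulate-take : ∀ a {n m} {f : Fin n → C} {g : Fin m → C} →
                n ≡ a ⊓ m → f ≐ g → tabulate f ≡ take a (tabulate g)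
tabulate-take zero    {n = zero}          refl _   = refl
tabulate-take (suc a) {n = zero} {zero}   refl _   = refl
tabulate-take (suc a) {n = suc n} {suc m} eq   f≐g =
  cong₂ _∷_ (f≐g zero zero refl)
            (tabulate-take a (suc-injective eq)
                           (λ i j e → f≐g (suc i) (suc j) (cong suc e)))

Connectedᶠ : (R : C → C → Set) → (Fin n → C) → Set
Connectedᶠ {n = n} R f =
  (j : Fin n) → 0 < toℕ j → Σ (Fin n) λ i → toℕ i < toℕ j × R (f i) (f j)

map-connectedᶠ : ∀ {D : Set} {R : C → C → Set} (S : D → D → Set) {f : Fin n → C} (g : C → D) →
                 (∀ x y → R x y → S (g x) (g y)) → Connectedᶠ R f → Connectedᶠ S (g ∘ f)
map-connectedᶠ S g g-hom c j 0<j with c j 0<j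
... | i , i<j , r = i , i<j , g-hom _ _ r

connectedᶠ-≐ : {R : C → C → Set} {f : Fin n → C} {g : Fin m → C} →
               n ≡ m → f ≐ g → Connectedᶠ R f → Connectedᶠ R g
connectedᶠ-≐ {R = R} refl f≐g c j 0<j with c j 0<j
... | i , i<j , r = i , i<j , subst₂ R (f≐g i i refl) (f≐g j j refl) r

tabulate-connected : (R : C → C → Set) (f : Fin n → C) →
                     Connectedᶠ R f → Connected R (tabulate f)
tabulate-connected R f = connectedᶠ-≐ {R = R} (sym (length-tabulate f))
  (λ i j i≡j → sym (lookup-tabulate-≐ f j i (sym i≡j)))

module _ {Pred : Set} {k : ℕ} {X : Pointed Pred} where

  Seq-≡ : {s t : Seq k X} → rest s ≡ rest t → s ≡ t
  Seq-≡ {mkSeq r _ _} {mkSeq .r _ _} refl = refl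

  ε-prefix : (s : Seq k X) (i : Fin (suc (length (rest s)))) →
             ε (prefix s i) ≡ lookup (elems s) i
  ε-prefix s = lastOf-take (point X) (rest s)

  prefix-last : (s : Seq k X) → prefix s (fromℕ (length (rest s))) ≡ s
  prefix-last s = Seq-≡ (trans (cong (λ a → take a (rest s)) (toℕ-fromℕ _))
                               (take-all _ (rest s) ≤-refl))

  prefix-⊑ : (s : Seq k X) (i : Fin (suc (length (rest s)))) → elems (prefix s i) ⊑ elems s
  prefix-⊑ s i = ∷-⊑ (point X) (take-⊑ (toℕ i) (rest s))

  prefix-mono : (s : Seq k X) {i j : Fin (suc (length (rest s)))} →
                toℕ i ≤ toℕ j → elems (prefix s i) ⊑ elems (prefix s j)
  prefix-mono s i≤j = ∷-⊑ (point X) (take-mono-⊑ (rest s) i≤j)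

  prefix-cong : (s t : Seq k X) → elems s ⊑ elems t →
                {i : Fin (suc (length (rest s)))} {j : Fin (suc (length (rest t)))} →
                toℕ i ≡ toℕ j → prefix s i ≡ prefix t j
  prefix-cong s t (zs , s++zs≡t) {i} {j} i≡j = Seq-≡ (begin
    take (toℕ i) (rest s)         ≡⟨ take-++ (toℕ i) (rest s) zs (toℕ≤pred[n] i) ⟨
    take (toℕ i) (rest s ++ zs)   ≡⟨ cong₂ take i≡j (∷-injectiveʳ s++zs≡t) ⟩
    take (toℕ j) (rest t)         ∎)

  prefixes-connected : (s : Seq k X) → Connected (E X) (elems s) →
                       Connectedᶠ (E (ℍ k X)) (prefix s)
  prefixes-connected s c j 0<j with c j 0<j
  ... | i , i<j , e = i , i<j , inj₁ (prefix-mono s (<⇒≤ i<j)) ,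
                      subst₂ (E X) (sym (ε-prefix s i)) (sym (ε-prefix s j)) e

counit : ∀ {Pred} {k} (X : Pointed Pred) → Hom (ℍ k X) X
fun    (counit X) = ε
pres-P (counit X) _ _ Ps      = Ps
pres-E (counit X) _ _ (_ , e) = e
pres-• (counit X) = refl

module _ {Pred : Set} {k : ℕ} {X Y : Pointed Pred} (h : Hom (ℍ k X) Y) where

  onPrefixes : (s : Seq k X) → Fin (suc (length (rest s))) → Carrier Y
  onPrefixes s = fun h ∘ prefix s

  extendRest : Seq k X → List (Carrier Y)
  extendRest s = tabulate (onPrefixes s ∘ suc)

  point∷extendRest : (s : Seq k X) → point Y ∷ extendRest s ≡ tabulate (onPrefixes s)
  point∷extendRest s = cong (_∷ extendRest s) (sym (pres-• h))

  onPrefixes-connected : (s : Seq k X) → Connected (E X) (elems s) →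
                         Connected (E Y) (point Y ∷ extendRest s)
  onPrefixes-connected s c = subst (Connected (E Y)) (sym (point∷extendRest s))
    (tabulate-connected (E Y) (onPrefixes s)
      (map-connectedᶠ (E Y) (fun h) (pres-E h) (prefixes-connected s c)))

  extendSeq : Seq k X → Seq k Y
  extendSeq s@(mkSeq _ l c) =
    mkSeq (extendRest s) (subst (_≤ k) (sym (length-tabulate _)) l) (onPrefixes-connected s c)

  ε-extendSeq : (s : Seq k X) → ε (extendSeq s) ≡ fun h s
  ε-extendSeq s = begin
    lastOf (point Y) (extendRest s)             ≡⟨ cong (λ y → lastOf y (extendRest s)) (pres-• h) ⟨
    lastOf (onPrefixes s zero) (extendRest s)   ≡⟨ lastOf-tabulate (onPrefixes s) ⟩
    fun h (prefix s (fromℕ (length (rest s))))  ≡⟨ cong (fun h) (prefix-last s) ⟩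
    fun h s                                     ∎

  extendSeq-mono : (s t : Seq k X) → elems s ⊑ elems t →
                   elems (extendSeq s) ⊑ elems (extendSeq t)
  extendSeq-mono s t s⊑t = ∷-⊑ (point Y)
    (subst (_⊑ extendRest t) (sym extendRest-take) (take-⊑ (length (rest s)) (extendRest t)))
    where
    extendRest-take : extendRest s ≡ take (length (rest s)) (extendRest t)
    extendRest-take = tabulate-take (length (rest s))
      (sym (m≤n⇒m⊓n≡m (s≤s⁻¹ (⊑-length s⊑t))))
      (λ i j i≡j → cong (fun h) (prefix-cong s t s⊑t (cong suc i≡j)))

  extend : Hom (ℍ k X) (ℍ k Y)
  fun    extend = extendSeq
  pres-P extend p s Ps = subst (P Y p) (sym (ε-extendSeq s)) (pres-P h p s Ps)
  pres-E extend s t (comparable , e) =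
    map⊎ (extendSeq-mono s t) (extendSeq-mono t s) comparable ,
    subst₂ (E Y) (sym (ε-extendSeq s)) (sym (ε-extendSeq t)) (pres-E h s t (comparable , e))
  pres-• extend = refl

  elems-extendSeq : (s : Seq k X) → elems (extendSeq s) ≡ starList h s
  elems-extendSeq s = trans (point∷extendRest s) (sym (map-tabulate id (onPrefixes s)))

  extendSeq-prefix : (s : Seq k X) {i : Fin (suc (length (rest s)))}
                     {j : Fin (suc (length (extendRest s)))} →
                     toℕ i ≡ toℕ j → extendSeq (prefix s i) ≡ prefix (extendSeq s) j
  extendSeq-prefix s {i} {j} i≡j = Seq-≡ (tabulate-take (toℕ j)
    (trans (length-take (toℕ i) (rest s)) (cong (_⊓ length (rest s)) i≡j))
    (λ a b a≡b → cong (fun h) (prefix-cong (prefix s i) s (prefix-⊑ s i) (cong suc a≡b))))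

extend-counit : ∀ {Pred} {k} (X : Pointed Pred) (s : Seq k X) → fun (extend (counit X)) s ≡ s
extend-counit X s =
  Seq-≡ (trans (tabulate-cong (λ i → ε-prefix s (suc i))) (tabulate-lookup (rest s)))

extend-∘ : ∀ {Pred} {k} {X Y Z : Pointed Pred}
           (h : Hom (ℍ k X) Y) (g : Hom (ℍ k Y) Z) (s : Seq k X) →
           fun (extend (g ∘H extend h)) s ≡ fun (extend g) (fun (extend h) s)
extend-∘ h g s = Seq-≡ (tabulate-≐ (sym (length-tabulate _))
  (λ i j i≡j → cong (fun g) (extendSeq-prefix h s (cong suc i≡j))))

mainTheorem19 :
  (Pred : Set) (k : ℕ) → 0 < k →
  -- (i) ε : ℍ_k(𝒜,a) → (𝒜,a) is a morphism
  Σ ((X : Pointed Pred) → Hom (ℍ k X) X) λ εH →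
    ((X : Pointed Pred) (s : Seq k X) → fun (εH X) s ≡ ε s) ×
  -- (ii) for every morphism h, h* is a well-defined morphism ℍ_k(𝒜,a) → ℍ_k(ℬ,b)
  Σ ({X Y : Pointed Pred} → Hom (ℍ k X) Y → Hom (ℍ k X) (ℍ k Y)) λ star →
    ({X Y : Pointed Pred} (h : Hom (ℍ k X) Y) (s : Seq k X) →
       elems (fun (star h) s) ≡ starList h s) ×
  -- (iii) the comonad laws in Kleisli form
    ({X Y : Pointed Pred} (h : Hom (ℍ k X) Y) (s : Seq k X) →
       ε (fun (star h) s) ≡ fun h s) ×
    ((X : Pointed Pred) (s : Seq k X) → fun (star (εH X)) s ≡ s) ×
    ({X Y Z : Pointed Pred} (h : Hom (ℍ k X) Y) (g : Hom (ℍ k Y) Z) (s : Seq k X) →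
       fun (star (g ∘H star h)) s ≡ fun (star g) (fun (star h) s))
mainTheorem19 Pred k _ =  -- the laws hold for k = 0 as well
  counit , (λ X s → refl) ,
  extend , elems-extendSeq , ε-extendSeq , extend-counit , extend-∘
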